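{- (1) Let $a$ be an approximate normal form and $\Pi\triangleright\Gamma\vdash_{\mathcal H} a:\sigma$. If $b$ is an approximate normal form with $a\le b$ (resp. $t$ is a $\lambda$-term with $a\le t$), then there exists a derivation $\Pi'\triangleright\Gamma\vdash_{\mathcal H} b:\sigma$ (resp. $\Pi'\triangleright\Gamma\vdash_{\mathcal H} t:\sigma$ with $t$ in $\Pi'$-normal form) such that $\mathcal A(\Pi')=\mathcal A(\Pi)$. (2) If $\Pi\triangleright\Gamma\vdash_{\mathcal H} a:\sigma$ for an approximate normal form $a$, or $\Pi\triangleright\Gamma\vdash_{\mathcal H} t:\sigma$ for a $\lambda$-term $t$ in $\Pi$-normal form, then there exists a derivation $\Pi'\triangleright\Gamma\vdash_{\mathcal H}\mathcal A(\Pi):\sigma$ with $\mathcal A(\Pi')=\mathcal A(\Pi)$.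
   Context: $\lambda$-terms $t::=x\mid\lambda x.t\mid tu$; a $\beta$-redex is a term $(\lambda x.t)u$. Types: $\sigma,\tau,\rho::=\alpha\mid A\to\tau$, $\alpha$ base types, multiset types $A=[\sigma_i]_{i\in I}$ finite possibly empty multisets. Environments $\Gamma$ map variables to multiset types, almost all $[\,]$; $(\Gamma+\Delta)(x)=\Gamma(x)\uplus\Delta(x)$; $\Gamma\setminus x$ sets $x$ to $[\,]$. System $\mathcal H$: (var) $x{:}[\rho]\vdash x:\rho$; ($\to$I) from $\Gamma\vdash t:\tau$ infer $\Gamma\setminus x\vdash\lambda x.t:\Gamma(x)\to\tau$; (m) from $(\Delta_i\vdash t:\sigma_i)_{i\in I}$ ($I$ finite, possibly empty) infer $+_{i\in I}\Delta_i\vdash t:[\sigma_i]_{i\in I}$; ($\to$E) from $\Gamma\vdash t:A\to\tau$ and $\Delta\vdash u:A$ infer $\Gamma+\Delta\vdash tu:\tau$. The rules also apply to approximate normal forms, $\Omega$ being typable only by (m) with $I=\emptyset$. Approximate normal forms: $a::=\Omega\mid N$, $N::=\lambda x.N\mid L$, $L::=x\mid L\,a$. $\le$ is the smallest order compatible with the constructors with $\Omega\le a$; for a $\lambda$-term $t$, $a\le t$ means $t$ arises from $a$ by replacing each occurrence of $\Omega$ by some term; $\bigvee$ denotes least upper bound. Typed positions: positions of $t$ are one-hole contexts $C$ with $C[u]=t$. $\mathrm{tocc}(\Pi)$ is $\{\square\}$ for (var); $\{\square\}\cup\{\lambda x.C:C\in\mathrm{tocc}(\Pi')\}$ for ($\to$I)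 with premise $\Pi'$; $\{\square\}\cup\{Cv:C\in\mathrm{tocc}(\Pi')\}\cup\{uC:C\in\mathrm{tocc}(\Pi'')\}$ for ($\to$E) with subject $uv$ and premises $\Pi'$ for $u$, $\Pi''$ for $v$; $\bigcup_i\mathrm{tocc}(\Pi_i)$ for (m) with premises $\Pi_i$. The subject $t$ is in $\Pi$-normal form if no subterm at a position in $\mathrm{tocc}(\Pi)$ is a $\beta$-redex (this always holds for approximate normal forms). Approximant of $\Pi$ (subject in $\Pi$-normal form): $\mathcal A(\Pi)=x$ for (var); $\lambda x.\mathcal A(\Pi')$ for ($\to$I); $\mathcal A(\Pi')\mathcal A(\Pi'')$ for ($\to$E); $\bigvee_{i\in I}\mathcal A(\Pi_i)$ for (m), $\Omega$ if $I=\emptyset$. -}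

module Defs where

open import Data.Nat using (ℕ; _≡ᵇ_)
open import Data.Bool using (if_then_else_)
open import Data.List using (List; []; _∷_; _++_; [_]; map)
open import Data.Maybe using (Maybe; just; nothing)
open import Data.Unit using (⊤)
open import Data.Empty using (⊥)
open import Data.Product using (Σ; _×_)
open import Relation.Nullary using (¬_)
open import Relation.Binary.PropositionalEquality using (_≡_)
open import Data.List.Membership.Propositional using (_∈_)

-- Syntax: one grammar containing Ω; λ-terms are the Ω-free elements,
-- approximate normal forms are given by the predicates IsA / IsN / IsL.

data Tm : Set where
  Ω   : Tm
  var : ℕ → Tm
  lam : ℕ → Tm → Tm
  app : Tm → Tm → Tm

data IsTerm : Tm → Set where
  var : ∀ x → IsTerm (var x)
  lam : ∀ x {t} → IsTerm t → IsTerm (lam x t)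
  app : ∀ {t u} → IsTerm t → IsTerm u → IsTerm (app t u)

mutual
  data IsA : Tm → Set where
    Ω : IsA Ω
    N : ∀ {a} → IsN a → IsA a

  data IsN : Tm → Set where
    lam : ∀ x {a} → IsN a → IsN (lam x a)
    L   : ∀ {a} → IsL a → IsN a

  data IsL : Tm → Set where
    var : ∀ x → IsL (var x)
    app : ∀ {l a} → IsL l → IsA a → IsL (app l a)

IsRedex : Tm → Set
IsRedex (app (lam x t) u) = ⊤
IsRedex _ = ⊥

data _≤_ : Tm → Tm → Set where
  Ω≤   : ∀ b → Ω ≤ b
  var≤ : ∀ x → var x ≤ var x
  lam≤ : ∀ x {a b} → a ≤ b → lam x a ≤ lam x b
  app≤ : ∀ {a a' b b'} → a ≤ b → a' ≤ b' → app a a' ≤ app b b'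

-- Binary join; it computes the least upper bound of two compatible
-- approximate normal forms (those with a common upper bound), which is
-- the only situation in which it is used (approximants of derivations in
-- normal form).  On incompatible inputs the value is irrelevant.
_⊔_ : Tm → Tm → Tm
Ω ⊔ b = b
a ⊔ Ω = a
var x ⊔ var y = var x
lam x a ⊔ lam y b = lam x (a ⊔ b)
app a a' ⊔ app b b' = app (a ⊔ b) (a' ⊔ b')
a ⊔ _ = a

-- Types.  Finite multisets are represented by lists; multiset equality is
-- the (deep) permutation equivalence _≈M_.

data Ty : Set where
  base : ℕ → Ty
  _⇒_  : List Ty → Ty → Ty

MTy : Set
MTy = List Ty

mutual
  data _≈T_ : Ty → Ty → Set where
    base : ∀ α → base α ≈T base α
    arr  : ∀ {A B σ τ} → A ≈M B → σ ≈T τ → (A ⇒ σ) ≈T (B ⇒ τ)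

  data _≈M_ : MTy → MTy → Set where
    []   : [] ≈M []
    cons : ∀ {σ τ A B C} → σ ≈T τ → A ≈M (B ++ C) → (σ ∷ A) ≈M (B ++ (τ ∷ C))

Env : Set
Env = ℕ → MTy

∅ : Env
∅ _ = []

_+ₑ_ : Env → Env → Env
(Γ +ₑ Δ) y = Γ y ++ Δ y

_∖_ : Env → ℕ → Env
(Γ ∖ x) y = if y ≡ᵇ x then [] else Γ y

_∶[_] : ℕ → Ty → Env
(x ∶[ ρ ]) y = if y ≡ᵇ x then [ ρ ] else []

-- The (m) rule with premises (Δ_i ⊢ t : σ_i)_{i∈I} is given as
-- a list of premises; the (→E) rule requires the multiset of the argument
-- to equal (as a multiset) the domain of the function type.

infix 4 _⊢_∶_ _⊢m_∶_

mutual
  data _⊢_∶_ : Env → Tm → Ty → Set where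
    ax   : ∀ x ρ → (x ∶[ ρ ]) ⊢ var x ∶ ρ
    lamI : ∀ {Γ x t τ} → Γ ⊢ t ∶ τ → (Γ ∖ x) ⊢ lam x t ∶ (Γ x ⇒ τ)
    appE : ∀ {Γ Δ t u A B τ} → Γ ⊢ t ∶ (A ⇒ τ) → Δ ⊢m u ∶ B → A ≈M B →
           (Γ +ₑ Δ) ⊢ app t u ∶ τ

  data _⊢m_∶_ : Env → Tm → MTy → Set where
    mnil  : ∀ {t} → ∅ ⊢m t ∶ []
    mcons : ∀ {Γ Δ t σ A} → Γ ⊢ t ∶ σ → Δ ⊢m t ∶ A → (Γ +ₑ Δ) ⊢m t ∶ (σ ∷ A)

-- Positions (one-hole contexts) as paths from the root.

data Dir : Set where
  body left right : Dir

Pos : Set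
Pos = List Dir

-- subterm at a position (C[u] = t  iff  subAt C t ≡ just u)
subAt : Pos → Tm → Maybe Tm
subAt [] t = just t
subAt (body ∷ p) (lam x t) = subAt p t
subAt (left ∷ p) (app t u) = subAt p t
subAt (right ∷ p) (app t u) = subAt p u
subAt (_ ∷ _) _ = nothing

mutual
  tocc : ∀ {Γ t σ} → Γ ⊢ t ∶ σ → List Pos
  tocc (ax x ρ) = [ [] ]
  tocc (lamI Π) = [] ∷ map (body ∷_) (tocc Π)
  tocc (appE Π Π' _) = [] ∷ (map (left ∷_) (tocc Π) ++ map (right ∷_) (toccm Π'))

  toccm : ∀ {Γ t A} → Γ ⊢m t ∶ A → List Pos
  toccm mnil = []
  toccm (mcons Π Ps) = tocc Π ++ toccm Ps

InNF : ∀ {Γ t σ} → Γ ⊢ t ∶ σ → Set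
InNF {t = t} Π = ∀ p → p ∈ tocc Π → ∀ u → subAt p t ≡ just u → ¬ IsRedex u

mutual
  appr : ∀ {Γ t σ} → Γ ⊢ t ∶ σ → Tm
  appr (ax x ρ) = var x
  appr (lamI {x = x} Π) = lam x (appr Π)
  appr (appE Π Π' _) = app (appr Π) (apprm Π')

  apprm : ∀ {Γ t A} → Γ ⊢m t ∶ A → Tm
  apprm mnil = Ω
  apprm (mcons Π Ps) = appr Π ⊔ apprm Ps

-- A derivation only inspects the subterms at its typed positions, and its
-- approximant records exactly those, with Ω elsewhere.  So moving the subject
-- up along ≤ (filling in Ω's) keeps the derivation and its approximant; the
-- filled-in subject stays in normal form because in an approximate normal form
-- every application has a variable-headed function part, which remains so.
-- Conversely appr Π ≤ t, and the approximants of the premises of an (m) rule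
-- have the common upper bound t, so each premise lifts to their join; this
-- types appr Π itself.
module Submission where

open import Defs
open import Data.Product using (Σ; _×_; _,_)
open import Relation.Binary.PropositionalEquality using (_≡_; refl; cong; cong₂; trans)
open import Data.List using ([]; _∷_; map)
open import Data.List.Membership.Propositional using (_∈_)
open import Data.List.Membership.Propositional.Properties using (∈-map⁻; ∈-++⁻)
open import Data.List.Relation.Unary.Any using (here; there)
open import Data.Sum using (inj₁; inj₂)
open import Relation.Nullary using (¬_)
open import Data.Maybe using (just)

≤-refl : ∀ a → a ≤ a
≤-refl Ω = Ω≤ Ω
≤-refl (var x) = var≤ x
≤-refl (lam x a) = lam≤ x (≤-refl a)
≤-refl (app a b) = app≤ (≤-refl a) (≤-refl b)

⊔-least : ∀ {a b t} → a ≤ t → b ≤ t → (a ⊔ b) ≤ t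
⊔-least (Ω≤ _) q = q
⊔-least (var≤ x) (Ω≤ _) = var≤ x
⊔-least (lam≤ x p) (Ω≤ _) = lam≤ x p
⊔-least (app≤ p p') (Ω≤ _) = app≤ p p'
⊔-least (var≤ x) (var≤ .x) = var≤ x
⊔-least (lam≤ x p) (lam≤ .x q) = lam≤ x (⊔-least p q)
⊔-least (app≤ p p') (app≤ q q') = app≤ (⊔-least p q) (⊔-least p' q')

⊔-upperˡ : ∀ {a b t} → a ≤ t → b ≤ t → a ≤ (a ⊔ b)
⊔-upperˡ (Ω≤ _) _ = Ω≤ _
⊔-upperˡ (var≤ x) (Ω≤ _) = var≤ x
⊔-upperˡ (var≤ x) (var≤ .x) = var≤ x
⊔-upperˡ (lam≤ x p) (Ω≤ _) = ≤-refl _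
⊔-upperˡ (lam≤ x p) (lam≤ .x q) = lam≤ x (⊔-upperˡ p q)
⊔-upperˡ (app≤ p p') (Ω≤ _) = ≤-refl _
⊔-upperˡ (app≤ p p') (app≤ q q') = app≤ (⊔-upperˡ p q) (⊔-upperˡ p' q')

⊔-upperʳ : ∀ {a b t} → a ≤ t → b ≤ t → b ≤ (a ⊔ b)
⊔-upperʳ (Ω≤ _) _ = ≤-refl _
⊔-upperʳ (var≤ x) (Ω≤ _) = Ω≤ _
⊔-upperʳ (var≤ x) (var≤ .x) = var≤ x
⊔-upperʳ (lam≤ x p) (Ω≤ _) = Ω≤ _
⊔-upperʳ (lam≤ x p) (lam≤ .x q) = lam≤ x (⊔-upperʳ p q)
⊔-upperʳ (app≤ p p') (Ω≤ _) = Ω≤ _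
⊔-upperʳ (app≤ p p') (app≤ q q') = app≤ (⊔-upperʳ p q) (⊔-upperʳ p' q')

mutual
  ⊢-mono : ∀ {Γ a b σ} → Γ ⊢ a ∶ σ → a ≤ b → Γ ⊢ b ∶ σ
  ⊢-mono (ax x ρ) (var≤ .x) = ax x ρ
  ⊢-mono (lamI Π) (lam≤ _ p) = lamI (⊢-mono Π p)
  ⊢-mono (appE Π Ps e) (app≤ p q) = appE (⊢-mono Π p) (⊢m-mono Ps q) e

  ⊢m-mono : ∀ {Γ a b A} → Γ ⊢m a ∶ A → a ≤ b → Γ ⊢m b ∶ A
  ⊢m-mono mnil _ = mnil
  ⊢m-mono (mcons Π Ps) p = mcons (⊢-mono Π p) (⊢m-mono Ps p)

mutual
  appr-⊢-mono : ∀ {Γ a b σ} (Π : Γ ⊢ a ∶ σ) (p : a ≤ b) → appr (⊢-mono Π p) ≡ appr Π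
  appr-⊢-mono (ax x ρ) (var≤ .x) = refl
  appr-⊢-mono (lamI Π) (lam≤ x p) = cong (lam x) (appr-⊢-mono Π p)
  appr-⊢-mono (appE Π Ps _) (app≤ p q) = cong₂ app (appr-⊢-mono Π p) (apprm-⊢m-mono Ps q)

  apprm-⊢m-mono : ∀ {Γ a b A} (Ps : Γ ⊢m a ∶ A) (p : a ≤ b) → apprm (⊢m-mono Ps p) ≡ apprm Ps
  apprm-⊢m-mono mnil _ = refl
  apprm-⊢m-mono (mcons Π Ps) p = cong₂ _⊔_ (appr-⊢-mono Π p) (apprm-⊢m-mono Ps p)

InNFm : ∀ {Γ t A} → Γ ⊢m t ∶ A → Set
InNFm {t = t} Ps = ∀ p → p ∈ toccm Ps → ∀ u → subAt p t ≡ just u → ¬ IsRedex u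

InNF-ax : ∀ x ρ → InNF (ax x ρ)
InNF-ax x ρ .[] (here refl) u refl ()
InNF-ax x ρ _ (there ()) _ _

InNF-lamI : ∀ {Γ x t τ} {Π : Γ ⊢ t ∶ τ} → InNF Π → InNF (lamI {x = x} Π)
InNF-lamI nf .[] (here refl) u refl ()
InNF-lamI nf _ (there m) u eq with ∈-map⁻ (body ∷_) m
... | q , qm , refl = nf q qm u eq

InNF-appE : ∀ {Γ Δ t u A B τ} {Π : Γ ⊢ t ∶ (A ⇒ τ)} {Ps : Δ ⊢m u ∶ B} {e : A ≈M B} →
            ¬ IsRedex (app t u) → InNF Π → InNFm Ps → InNF (appE Π Ps e)
InNF-appE ¬redex _ _ .[] (here refl) _ refl = ¬redex
InNF-appE {Π = Π} _ nfΠ nfPs _ (there m) v eq with ∈-++⁻ (map (left ∷_) (tocc Π)) m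
... | inj₁ m₁ with ∈-map⁻ (left ∷_) m₁
...   | q , qm , refl = nfΠ q qm v eq
InNF-appE _ _ nfPs _ (there m) v eq | inj₂ m₂ with ∈-map⁻ (right ∷_) m₂
...   | q , qm , refl = nfPs q qm v eq

InNFm-mnil : ∀ {t} → InNFm (mnil {t = t})
InNFm-mnil _ ()

InNFm-mcons : ∀ {Γ Δ t σ A} {Π : Γ ⊢ t ∶ σ} {Ps : Δ ⊢m t ∶ A} →
              InNF Π → InNFm Ps → InNFm (mcons Π Ps)
InNFm-mcons {Π = Π} nfΠ nfPs p m u eq with ∈-++⁻ (tocc Π) m
... | inj₁ m₁ = nfΠ p m₁ u eq
... | inj₂ m₂ = nfPs p m₂ u eq

IsL-≤⇒¬IsRedex-app : ∀ {l t u} → IsL l → l ≤ t → ¬ IsRedex (app t u)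
IsL-≤⇒¬IsRedex-app (var x) (var≤ .x) ()
IsL-≤⇒¬IsRedex-app (app _ _) (app≤ _ _) ()

mutual
  InNF-⊢-mono : ∀ {Γ a b σ} (Π : Γ ⊢ a ∶ σ) → IsA a → (p : a ≤ b) → InNF (⊢-mono Π p)
  InNF-⊢-mono (ax x ρ) _ (var≤ .x) = InNF-ax x ρ
  InNF-⊢-mono (lamI Π) (N (lam _ n)) (lam≤ _ p) = InNF-lamI (InNF-⊢-mono Π (N n) p)
  InNF-⊢-mono (lamI Π) (N (L ())) _
  InNF-⊢-mono (appE Π Ps e) (N (L (app l a))) (app≤ p q) =
    InNF-appE {Ps = ⊢m-mono Ps q} {e = e} (IsL-≤⇒¬IsRedex-app l p) (InNF-⊢-mono Π (N (L l)) p) (InNFm-⊢m-mono Ps a q)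

  InNFm-⊢m-mono : ∀ {Γ a b A} (Ps : Γ ⊢m a ∶ A) → IsA a → (p : a ≤ b) → InNFm (⊢m-mono Ps p)
  InNFm-⊢m-mono mnil _ _ = InNFm-mnil
  InNFm-⊢m-mono (mcons Π Ps) a p =
    InNFm-mcons {Ps = ⊢m-mono Ps p} (InNF-⊢-mono Π a p) (InNFm-⊢m-mono Ps a p)

mutual
  appr-≤ : ∀ {Γ t σ} (Π : Γ ⊢ t ∶ σ) → appr Π ≤ t
  appr-≤ (ax x ρ) = var≤ x
  appr-≤ (lamI {x = x} Π) = lam≤ x (appr-≤ Π)
  appr-≤ (appE Π Ps _) = app≤ (appr-≤ Π) (apprm-≤ Ps)

  apprm-≤ : ∀ {Γ t A} (Ps : Γ ⊢m t ∶ A) → apprm Ps ≤ t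
  apprm-≤ mnil = Ω≤ _
  apprm-≤ (mcons Π Ps) = ⊔-least (appr-≤ Π) (apprm-≤ Ps)

mutual
  ⊢-appr : ∀ {Γ t σ} (Π : Γ ⊢ t ∶ σ) → Γ ⊢ appr Π ∶ σ
  ⊢-appr (ax x ρ) = ax x ρ
  ⊢-appr (lamI Π) = lamI (⊢-appr Π)
  ⊢-appr (appE Π Ps e) = appE (⊢-appr Π) (⊢m-apprm Ps) e

  ⊢m-apprm : ∀ {Γ t A} (Ps : Γ ⊢m t ∶ A) → Γ ⊢m apprm Ps ∶ A
  ⊢m-apprm mnil = mnil
  ⊢m-apprm (mcons Π Ps) =
    mcons (⊢-mono (⊢-appr Π) (⊔-upperˡ (appr-≤ Π) (apprm-≤ Ps)))
          (⊢m-mono (⊢m-apprm Ps) (⊔-upperʳ (appr-≤ Π) (apprm-≤ Ps)))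

mutual
  appr-⊢-appr : ∀ {Γ t σ} (Π : Γ ⊢ t ∶ σ) → appr (⊢-appr Π) ≡ appr Π
  appr-⊢-appr (ax x ρ) = refl
  appr-⊢-appr (lamI {x = x} Π) = cong (lam x) (appr-⊢-appr Π)
  appr-⊢-appr (appE Π Ps _) = cong₂ app (appr-⊢-appr Π) (apprm-⊢m-apprm Ps)

  apprm-⊢m-apprm : ∀ {Γ t A} (Ps : Γ ⊢m t ∶ A) → apprm (⊢m-apprm Ps) ≡ apprm Ps
  apprm-⊢m-apprm mnil = refl
  apprm-⊢m-apprm (mcons Π Ps) =
    cong₂ _⊔_ (trans (appr-⊢-mono (⊢-appr Π) _) (appr-⊢-appr Π))
              (trans (apprm-⊢m-mono (⊢m-apprm Ps) _) (apprm-⊢m-apprm Ps))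

proposition3p9 : ((∀ {Γ a σ} (Π : Γ ⊢ a ∶ σ) → IsA a → ∀ b → IsA b → a ≤ b →
    Σ (Γ ⊢ b ∶ σ) (λ Π' → appr Π' ≡ appr Π))
    × (∀ {Γ a σ} (Π : Γ ⊢ a ∶ σ) → IsA a → ∀ t → IsTerm t → a ≤ t →
    Σ (Γ ⊢ t ∶ σ) (λ Π' → InNF Π' × appr Π' ≡ appr Π)))
    × ((∀ {Γ a σ} (Π : Γ ⊢ a ∶ σ) → IsA a →
    Σ (Γ ⊢ appr Π ∶ σ) (λ Π' → appr Π' ≡ appr Π))
    × (∀ {Γ t σ} (Π : Γ ⊢ t ∶ σ) → IsTerm t → InNF Π →
    Σ (Γ ⊢ appr Π ∶ σ) (λ Π' → appr Π' ≡ appr Π)))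
proposition3p9 =
  ( (λ Π _ _ _ p → ⊢-mono Π p , appr-⊢-mono Π p)
  , (λ Π a _ _ p → ⊢-mono Π p , InNF-⊢-mono Π a p , appr-⊢-mono Π p))
  , ( (λ Π _ → ⊢-appr Π , appr-⊢-appr Π)
    , (λ Π _ _ → ⊢-appr Π , appr-⊢-appr Π))
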